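{- There exist constants $C,C'>0$ such that for every projective plane $\Pi$, if its incidence graph $\Gamma_\Pi$ has $N$ vertices, then $C\sqrt{N}\le\mu(\Gamma_\Pi)\le C'\sqrt{N}$; that is, $\mu(\Gamma_\Pi)=\Theta(\sqrt N)$.
   Context: A projective plane of order $q$ has $q^2+q+1$ points and $q^2+q+1$ lines, each line having $q+1$ points. Its incidence graph $\Gamma_\Pi$ is the bipartite graph on points and lines, a point adjacent to a line iff it lies on it; so $N=2(q^2+q+1)$. $\mu$ denotes metric dimension: the minimum size of a vertex set $R$ such that any two distinct vertices $x,y$ have some $w\in R$ with $\d(x,w)\ne\d(y,w)$, where $\d$ is path distance. -}

module Defs where

open import Data.Nat using (ℕ; zero; suc; _+_; _≤_)
open import Data.Fin using (Fin; splitAt)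
open import Data.Fin.Subset using (Subset; _∈_; ∣_∣)
open import Data.Sum using (_⊎_; inj₁; inj₂)
open import Data.Product using (Σ; _×_; ∃; ∃-syntax; _,_)
open import Data.Empty using (⊥)
open import Relation.Nullary using (¬_)
open import Relation.Binary.PropositionalEquality using (_≡_; _≢_)

record Graph : Set₁ where
  field
    n   : ℕ
    Adj : Fin n → Fin n → Set

module _ (G : Graph) where
  open Graph G

  data Walk : Fin n → Fin n → ℕ → Set where
    here : ∀ {u} → Walk u u zero
    step : ∀ {u w v k} → Adj u w → Walk w v k → Walk u v (suc k)

  Dist : Fin n → Fin n → ℕ → Set
  Dist u v k = Walk u v k × (∀ j → Walk u v j → k ≤ j)

  Distinguishes : Fin n → Fin n → Fin n → Set
  Distinguishes w x y = ∀ k → Dist x w k → ¬ Dist y w k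

  Resolving : Subset n → Set
  Resolving R = ∀ x y → x ≢ y → ∃[ w ] (w ∈ R × Distinguishes w x y)

  IsMetricDim : ℕ → Set
  IsMetricDim m = (∃[ R ] (Resolving R × ∣ R ∣ ≡ m))
                × (∀ R → Resolving R → m ≤ ∣ R ∣)

record ProjectivePlane : Set₁ where
  field
    p l : ℕ
    I   : Fin p → Fin l → Set
    lineThrough : ∀ x y → x ≢ y →
      ∃[ L ] (I x L × I y L × (∀ L' → I x L' → I y L' → L' ≡ L))
    meet : ∀ L M → L ≢ M →
      ∃[ x ] (I x L × I x M × (∀ x' → I x' L → I x' M → x' ≡ x))
    nondegenerate : ∃[ a ] ∃[ b ] ∃[ c ] ∃[ d ]
      (a ≢ b × a ≢ c × a ≢ d × b ≢ c × b ≢ d × c ≢ d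
      × (¬ (∃[ L ] (I a L × I b L × I c L)))
      × (¬ (∃[ L ] (I a L × I b L × I d L)))
      × (¬ (∃[ L ] (I a L × I c L × I d L)))
      × (¬ (∃[ L ] (I b L × I c L × I d L))))

-- incidence graph Γ_Π on Fin (p + l): first p vertices are points,
-- the remaining l are lines; point ~ line iff incident.
incidenceGraph : ProjectivePlane → Graph
incidenceGraph Π = record { n = p + l ; Adj = adj }
  where
  open ProjectivePlane Π
  adj' : Fin p ⊎ Fin l → Fin p ⊎ Fin l → Set
  adj' (inj₁ x) (inj₂ L) = I x L
  adj' (inj₂ L) (inj₁ x) = I x L
  adj' (inj₁ _) (inj₁ _) = ⊥
  adj' (inj₂ _) (inj₂ _) = ⊥
  adj : Fin (p + l) → Fin (p + l) → Set
  adj u v = adj' (splitAt p u) (splitAt p v)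

module Submission where

-- Distances in the incidence graph are 0, 1, 2 or 3 and are determined by equality, incidence and
-- the kinds (point or line) of the two vertices.  Hence two vertices of the same kind are resolved
-- only by a vertex equal or adjacent to exactly one of them, and two distinct vertices of the same
-- kind cannot share two such vertices.  So a vertex is determined by its kind and at most two of its
-- closed neighbours in a resolving set R, and each kind has at most (|R|+1)² members.  Conversely,
-- for a quadrangle a, b, c, d the points on ab or ac and the lines through a or b form a resolving
-- set of size at most 4(q+1), while the lines through d and through a other than ad meet pairwise
-- in distinct points, so q² ≤ p.  Incidence is only decidable up to double negation, which
-- suffices because the conclusion is decidable.

open import Defs
open import Data.Bool using (Bool; true; false) renaming (_≟_ to _≟ᵇ_)
open import Data.Bool.Properties using (¬-not)
open import Data.Empty using (⊥; ⊥-elim)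
open import Data.Fin using (Fin; zero; suc; splitAt; join; combine; _≟_)
open import Data.Fin.Properties
  using (any?; toℕ<n; combine-injective; injective⇒≤; suc-injective; splitAt-join; join-splitAt; splitAt-↑ˡ; splitAt-↑ʳ)
open import Data.Fin.Subset using (Subset; ∣_∣) renaming (_∈_ to _∈ₛ_)
open import Data.List using (List; []; _∷_; _++_; length; lookup; map; filter; allFin; cartesianProduct)
open import Data.List.Properties using (length-map; length-++; length-tabulate; length-removeAt′)
open import Data.List.Membership.Propositional using (_∈_)
open import Data.List.Membership.Propositional.Properties
  using (∈-map⁺; ∈-map⁻; ∈-filter⁺; ∈-filter⁻; ∈-allFin; ∈-++⁺ˡ; ∈-++⁺ʳ; ∈-cartesianProduct⁻; ∈-length)
open import Data.List.Relation.Unary.All as All using ()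
open import Data.List.Relation.Unary.AllPairs using (_∷_; [])
open import Data.List.Relation.Unary.Any using (here; there; index; _─_)
open import Data.List.Relation.Unary.Any.Properties using (lookup-index)
open import Data.List.Relation.Unary.Unique.Propositional using (Unique)
import Data.List.Relation.Unary.Unique.Propositional.Properties as Unique
open import Data.Maybe using (Maybe; just; nothing)
open import Data.Nat using (ℕ; zero; suc; _+_; _*_; _≤_; _<_; _≤?_; z≤n; s≤s)
open import Data.Nat.Properties
  using (≤-trans; ≤-<-trans; ≤-antisym; ≮⇒≥; +-mono-≤; +-monoˡ-≤; *-mono-≤; *-monoʳ-≤; m≤m+n; module ≤-Reasoning)
open import Data.Nat.Tactic.RingSolver using (solve-∀)
open import Data.Product using (_×_; _,_; ∃; ∃₂; ∃-syntax; proj₁; proj₂)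
open import Data.Sum using (_⊎_; inj₁; inj₂)
open import Data.Sum.Properties using (≡-dec; inj₁-injective; inj₂-injective)
open import Data.Vec using (_∷_; []; tabulate) renaming (here to hereₛ; there to thereₛ)
open import Data.Vec.Properties using (lookup∘tabulate; []=⇒lookup; lookup⇒[]=)
open import Function using (_∘_; id; flip)
open import Relation.Binary.Definitions using (DecidableEquality)
open import Relation.Binary.PropositionalEquality
  using (_≡_; _≢_; refl; sym; trans; cong; cong₂; subst; subst₂; module ≡-Reasoning)
open import Relation.Nullary using (¬_; ¬?; Dec; yes; no; does)
open import Relation.Nullary.Decidable
  using (_⊎-dec_; _×-dec_; map′; dec-true; decidable-stable; ¬¬-excluded-middle)

∈-─⁺ : ∀ {A : Set} {x y : A} {ys : List A} (y∈ys : y ∈ ys) → x ∈ ys → x ≢ y → x ∈ (ys ─ y∈ys)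
∈-─⁺ (here refl) (here refl) x≢y = ⊥-elim (x≢y refl)
∈-─⁺ (here _)    (there x∈ys) _  = x∈ys
∈-─⁺ (there _)   (here refl)  _  = here refl
∈-─⁺ (there y∈ys) (there x∈ys) x≢y = there (∈-─⁺ y∈ys x∈ys x≢y)

injection⇒length≤ : ∀ {A B : Set} {R : A → B → Set} {xs : List A} {ys : List B} →
  Unique xs →
  (∀ {x} → x ∈ xs → ∃[ y ] (y ∈ ys × R x y)) →
  (∀ {x x′ y} → x ∈ xs → x′ ∈ xs → R x y → R x′ y → x ≡ x′) →
  length xs ≤ length ys
injection⇒length≤ {xs = []} _ _ _ = z≤n
injection⇒length≤ {R = R} {xs = x ∷ xs} {ys} (x∉xs ∷ xs!) partner injective
  with y , y∈ys , Rxy ← partner (here refl) = begin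
    suc (length xs)          ≤⟨ s≤s (injection⇒length≤ xs! partner′ injective′) ⟩
    suc (length (ys ─ y∈ys)) ≡⟨ sym (length-removeAt′ ys (index y∈ys)) ⟩
    length ys                ∎
  where
  open ≤-Reasoning
  injective′ : ∀ {x x′ y} → x ∈ xs → x′ ∈ xs → R x y → R x′ y → x ≡ x′
  injective′ x∈ x′∈ = injective (there x∈) (there x′∈)
  partner′ : ∀ {x′} → x′ ∈ xs → ∃[ y′ ] (y′ ∈ (ys ─ y∈ys) × R x′ y′)
  partner′ x′∈xs with y′ , y′∈ys , Rx′y′ ← partner (there x′∈xs) =
    y′ , ∈-─⁺ y∈ys y′∈ys y′≢y , Rx′y′
    where
    y′≢y : y′ ≢ y
    y′≢y refl = All.lookup x∉xs x′∈xs (injective (here refl) (there x′∈xs) Rxy Rx′y′)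

length-cartesianProduct : ∀ {A B : Set} (xs : List A) (ys : List B) →
  length (cartesianProduct xs ys) ≡ length xs * length ys
length-cartesianProduct []       ys = refl
length-cartesianProduct (x ∷ xs) ys = begin
  length (map (x ,_) ys ++ cartesianProduct xs ys)
    ≡⟨ length-++ (map (x ,_) ys) ⟩
  length (map (x ,_) ys) + length (cartesianProduct xs ys)
    ≡⟨ cong₂ _+_ (length-map (x ,_) ys) (length-cartesianProduct xs ys) ⟩
  length ys + length xs * length ys ∎
  where open ≡-Reasoning

length≤suc-length-without : ∀ {A : Set} (_≟_ : DecidableEquality A) y {xs : List A} → Unique xs →
  length xs ≤ suc (length (filter (λ x → ¬? (x ≟ y)) xs))
length≤suc-length-without _≟_ y {xs} xs! =
  injection⇒length≤ {R = _≡_} xs! partner λ _ _ → λ { refl refl → refl }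
  where
  partner : ∀ {x} → x ∈ xs → ∃[ x′ ] (x′ ∈ y ∷ filter (λ x → ¬? (x ≟ y)) xs × x ≡ x′)
  partner {x} x∈ with x ≟ y
  ... | yes refl = x , here refl , refl
  ... | no x≢y   = x , there (∈-filter⁺ (λ x → ¬? (x ≟ y)) x∈ x≢y) , refl

elements : ∀ {n} → Subset n → List (Fin n)
elements []          = []
elements (true ∷ p)  = zero ∷ map suc (elements p)
elements (false ∷ p) = map suc (elements p)

length-elements : ∀ {n} (p : Subset n) → length (elements p) ≡ ∣ p ∣
length-elements []          = refl
length-elements (true ∷ p)  = cong suc (trans (length-map suc (elements p)) (length-elements p))
length-elements (false ∷ p) = trans (length-map suc (elements p)) (length-elements p)

∈-elements⁺ : ∀ {n} {p : Subset n} {x} → x ∈ₛ p → x ∈ elements p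
∈-elements⁺ {p = true ∷ p}  hereₛ      = here refl
∈-elements⁺ {p = true ∷ p}  (thereₛ x∈p) = there (∈-map⁺ suc (∈-elements⁺ x∈p))
∈-elements⁺ {p = false ∷ p} (thereₛ x∈p) = ∈-map⁺ suc (∈-elements⁺ x∈p)

∈-elements⁻ : ∀ {n} (p : Subset n) {x} → x ∈ elements p → x ∈ₛ p
∈-elements⁻ (true ∷ p) (here refl) = hereₛ
∈-elements⁻ (true ∷ p) (there x∈)
  with _ , x∈p , refl ← ∈-map⁻ suc x∈ = thereₛ (∈-elements⁻ p x∈p)
∈-elements⁻ (false ∷ p) x∈
  with _ , x∈p , refl ← ∈-map⁻ suc x∈ = thereₛ (∈-elements⁻ p x∈p)

elements-unique : ∀ {n} (p : Subset n) → Unique (elements p)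
elements-unique []          = []
elements-unique (true ∷ p)  = All.tabulate zero∉ ∷ Unique.map⁺ suc-injective (elements-unique p)
  where
  zero∉ : ∀ {x} → x ∈ map suc (elements p) → zero ≢ x
  zero∉ x∈ with _ , _ , refl ← ∈-map⁻ suc x∈ = λ ()
elements-unique (false ∷ p) = Unique.map⁺ suc-injective (elements-unique p)

injection⇒∣p∣≤length : ∀ {n} {B : Set} {R : Fin n → B → Set} {p : Subset n} {ys : List B} →
  (∀ {x} → x ∈ₛ p → ∃[ y ] (y ∈ ys × R x y)) →
  (∀ {x x′ y} → R x y → R x′ y → x ≡ x′) →
  ∣ p ∣ ≤ length ys
injection⇒∣p∣≤length {p = p} partner injective =
  subst (_≤ _) (length-elements p)
    (injection⇒length≤ (elements-unique p) (λ x∈ → partner (∈-elements⁻ p x∈)) (λ _ _ → injective))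

subset : ∀ {n} {P : Fin n → Set} → (∀ x → Dec (P x)) → Subset n
subset P? = tabulate (does ∘ P?)

∈-subset⁺ : ∀ {n} {P : Fin n → Set} {P? : ∀ x → Dec (P x)} {x} → P x → x ∈ₛ subset P?
∈-subset⁺ {P? = P?} {x} Px = lookup⇒[]= x (subset P?) (trans (lookup∘tabulate _ x) (dec-true (P? x) Px))

∈-subset⁻ : ∀ {n} {P : Fin n → Set} {P? : ∀ x → Dec (P x)} {x} → x ∈ₛ subset P? → P x
∈-subset⁻ {P = P} {P?} {x} x∈ = accepted (P? x) (trans (sym (lookup∘tabulate _ x)) ([]=⇒lookup x∈))
  where
  accepted : (Px? : Dec (P x)) → does Px? ≡ true → P x
  accepted (yes Px) _ = Px

¬¬-∀-Fin : ∀ n {P : Fin n → Set} → (∀ i → ¬ ¬ P i) → ¬ ¬ (∀ i → P i)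
¬¬-∀-Fin zero    _    ¬∀ = ¬∀ λ ()
¬¬-∀-Fin (suc n) ¬¬P ¬∀ = ¬¬P zero λ P₀ → ¬¬-∀-Fin n (λ i → ¬¬P (suc i)) λ P₊ →
  ¬∀ λ { zero → P₀ ; (suc i) → P₊ i }

≢-≢⇒≡ : ∀ {x y z : Bool} → x ≢ y → y ≢ z → x ≡ z
≢-≢⇒≡ x≢y y≢z = trans (¬-not x≢y) (sym (¬-not (y≢z ∘ sym)))

suc≤double : ∀ {n} → 1 ≤ n → suc n ≤ n + n
suc≤double {n} 1≤n = +-monoˡ-≤ n 1≤n

square-bound : ∀ {m n r} → 1 ≤ r → m ≤ suc r * suc r → n ≤ suc r * suc r → m + n ≤ 8 * (r * r)
square-bound {m} {n} {r} 1≤r m≤ n≤ = begin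
  m + n                                   ≤⟨ +-mono-≤ (≤-trans m≤ r₊²≤) (≤-trans n≤ r₊²≤) ⟩
  (r + r) * (r + r) + (r + r) * (r + r)   ≡⟨ identity r ⟩
  8 * (r * r)                             ∎
  where
  open ≤-Reasoning
  r₊²≤ : suc r * suc r ≤ (r + r) * (r + r)
  r₊²≤ = *-mono-≤ (suc≤double 1≤r) (suc≤double 1≤r)
  identity : ∀ r → (r + r) * (r + r) + (r + r) * (r + r) ≡ 8 * (r * r)
  identity = solve-∀

product-bound : ∀ {μ k α β n} → μ ≤ 4 * k → k ≤ suc α → k ≤ suc β → 1 ≤ α → 1 ≤ β → α * β ≤ n →
  μ * μ ≤ 64 * n
product-bound {μ} {k} {α} {β} {n} μ≤4k k≤α₊ k≤β₊ 1≤α 1≤β αβ≤n = begin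
  μ * μ                               ≤⟨ *-mono-≤ (μ≤ k≤α₊ 1≤α) (μ≤ k≤β₊ 1≤β) ⟩
  (4 * (α + α)) * (4 * (β + β))       ≡⟨ identity α β ⟩
  64 * (α * β)                        ≤⟨ *-monoʳ-≤ 64 αβ≤n ⟩
  64 * n                              ∎
  where
  open ≤-Reasoning
  μ≤ : ∀ {γ} → k ≤ suc γ → 1 ≤ γ → μ ≤ 4 * (γ + γ)
  μ≤ k≤γ₊ 1≤γ = ≤-trans μ≤4k (*-monoʳ-≤ 4 (≤-trans k≤γ₊ (suc≤double 1≤γ)))
  identity : ∀ α β → (4 * (α + α)) * (4 * (β + β)) ≡ 64 * (α * β)
  identity = solve-∀

toFin : ∀ {r} → Maybe (Fin r) → Fin (suc r)
toFin nothing  = zero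
toFin (just i) = suc i

toFin-injective : ∀ {r} {i j : Maybe (Fin r)} → toFin i ≡ toFin j → i ≡ j
toFin-injective {i = nothing} {nothing} _  = refl
toFin-injective {i = just _}  {just _}  eq = cong just (suc-injective eq)
toFin-injective {i = nothing} {just _}  ()
toFin-injective {i = just _}  {nothing} ()

module CloseCode {A B : Set} (_≟_ : DecidableEquality B) (C : A → B → Set) (C? : ∀ a b → Dec (C a b))
  {r : ℕ} (enum : Fin r → B) where

  Near : A → Fin r → Set
  Near a i = C a (enum i)

  NearOtherThan : A → Fin r → Fin r → Set
  NearOtherThan a i j = Near a j × enum j ≢ enum i

  found : {P : Fin r → Set} → Dec (∃ P) → Maybe (Fin r)
  found (yes (i , _)) = just i
  found (no _)        = nothing

  second : ∀ a → Dec (∃ (Near a)) → Maybe (Fin r)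
  second a (yes (i , _)) = found (any? λ j → C? a (enum j) ×-dec ¬? (enum j ≟ enum i))
  second a (no _)        = nothing

  code : A → Maybe (Fin r) × Maybe (Fin r)
  code a = found (any? (C? a ∘ enum)) , second a (any? (C? a ∘ enum))

  EquallyNear : A → A → Set
  EquallyNear a a′ = (∀ i → Near a i → Near a′ i) × (∀ i → Near a′ i → Near a i)

  TwoCommonNear : A → A → Set
  TwoCommonNear a a′ = ∃₂ λ b b′ → b ≢ b′ × C a b × C a b′ × C a′ b × C a′ b′

  only-near : ∀ {a a′ i} → ¬ ∃ (NearOtherThan a i) → Near a′ i → ∀ k → Near a k → Near a′ k
  only-near {i = i} none a′i k ak with enum k ≟ enum i
  ... | yes k≡i = subst (C _) (sym k≡i) a′i
  ... | no k≢i  = ⊥-elim (none (k , ak , k≢i))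

  same-code : ∀ {a a′} → code a ≡ code a′ → EquallyNear a a′ ⊎ TwoCommonNear a a′
  same-code {a} {a′} eq =
    by-first (any? (C? a ∘ enum)) (any? (C? a′ ∘ enum)) (cong proj₁ eq) (cong proj₂ eq)
    where
    by-first : (d : Dec (∃ (Near a))) (d′ : Dec (∃ (Near a′))) →
      found d ≡ found d′ → second a d ≡ second a′ d′ → EquallyNear a a′ ⊎ TwoCommonNear a a′
    by-first (no ¬a) (no ¬a′) _ _ =
      inj₁ ((λ i ai → ⊥-elim (¬a (i , ai))) , (λ i a′i → ⊥-elim (¬a′ (i , a′i))))
    by-first (yes (i , ai)) (yes (_ , a′i)) refl eq₂ =
      by-second (any? λ j → C? a (enum j) ×-dec ¬? (enum j ≟ enum i))
                (any? λ j → C? a′ (enum j) ×-dec ¬? (enum j ≟ enum i)) eq₂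
      where
      by-second : (d : Dec (∃ (NearOtherThan a i))) (d′ : Dec (∃ (NearOtherThan a′ i))) →
        found d ≡ found d′ → EquallyNear a a′ ⊎ TwoCommonNear a a′
      by-second (yes (j , aj , j≢i)) (yes (_ , a′j , _)) refl =
        inj₂ (enum j , enum i , j≢i , aj , ai , a′j , a′i)
      by-second (no none) (no none′) _ = inj₁ (only-near none a′i , only-near none′ ai)
      by-second (yes _) (no _)  ()
      by-second (no _)  (yes _) ()
    by-first (yes _) (no _)  ()
    by-first (no _)  (yes _) ()

module _ (G : Graph) where
  open Graph G

  Dist-unique : ∀ {u v k k′} → Dist G u v k → Dist G u v k′ → k ≡ k′
  Dist-unique (w , least) (w′ , least′) = ≤-antisym (least _ w′) (least′ _ w)

  shortest⇒Dist : ∀ {u v k} → Walk G u v k → (∀ {j} → j < k → ¬ Walk G u v j) → Dist G u v k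
  shortest⇒Dist w shorter = w , λ j w′ → ≮⇒≥ λ j<k → shorter j<k w′

module LinearSpace {m n : ℕ} (I : Fin m → Fin n → Set) (I? : ∀ x M → Dec (I x M))
  (join : ∀ x y → x ≢ y → ∃[ M ] (I x M × I y M × (∀ M′ → I x M′ → I y M′ → M′ ≡ M)))
  where

  join-unique : ∀ {x y M M′} → x ≢ y → I x M → I y M → I x M′ → I y M′ → M ≡ M′
  join-unique x≢y xM yM xM′ yM′ with _ , _ , _ , unique ← join _ _ x≢y =
    trans (unique _ xM yM) (sym (unique _ xM′ yM′))

  separating-line : ∀ {a b x y M} → a ≢ b → I a M → I b M → ¬ I x M → x ≢ y →
    ∃[ N ] ((I a N ⊎ I b N) × I x N × ¬ I y N)
  separating-line {a} {b} {x} {y} {M} a≢b aM bM x∉M x≢y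
    with join a x (λ { refl → x∉M aM }) | join b x (λ { refl → x∉M bM })
  ... | A , aA , xA , _ | B , bB , xB , _ with I? y A | I? y B
  ... | no y∉A | _      = A , inj₁ aA , xA , y∉A
  ... | yes _  | no y∉B = B , inj₂ bB , xB , y∉B
  ... | yes yA | yes yB = ⊥-elim (x∉M (subst (I x) (sym M≡A) xA))
    where
    A≡B : A ≡ B
    A≡B = join-unique x≢y xA yA xB yB
    M≡A : M ≡ A
    M≡A = join-unique a≢b aM bM aA (subst (I b) (sym A≡B) bB)

  line-of : ∀ {x y} → x ≢ y → Fin n
  line-of x≢y = proj₁ (join _ _ x≢y)

  on-line-ofˡ : ∀ {x y} (x≢y : x ≢ y) → I x (line-of x≢y)
  on-line-ofˡ x≢y = proj₁ (proj₂ (join _ _ x≢y))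

  on-line-ofʳ : ∀ {x y} (x≢y : x ≢ y) → I y (line-of x≢y)
  on-line-ofʳ x≢y = proj₁ (proj₂ (proj₂ (join _ _ x≢y)))

  on : Fin n → List (Fin m)
  on M = filter (λ x → I? x M) (allFin m)

  through : Fin m → List (Fin n)
  through x = filter (I? x) (allFin n)

  ∈-on⁺ : ∀ {x M} → I x M → x ∈ on M
  ∈-on⁺ {x} xM = ∈-filter⁺ _ (∈-allFin x) xM

  ∈-on⁻ : ∀ {x M} → x ∈ on M → I x M
  ∈-on⁻ x∈ = proj₂ (∈-filter⁻ _ {xs = allFin _} x∈)

  ∈-through⁺ : ∀ {x M} → I x M → M ∈ through x
  ∈-through⁺ {M = M} xM = ∈-filter⁺ _ (∈-allFin M) xM

  ∈-through⁻ : ∀ {x M} → M ∈ through x → I x M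
  ∈-through⁻ M∈ = proj₂ (∈-filter⁻ _ {xs = allFin _} M∈)

  on-unique : ∀ M → Unique (on M)
  on-unique M = Unique.filter⁺ _ (Unique.allFin⁺ m)

  through-unique : ∀ x → Unique (through x)
  through-unique x = Unique.filter⁺ _ (Unique.allFin⁺ n)

  length-on≤length-through : ∀ {z M} → ¬ I z M → length (on M) ≤ length (through z)
  length-on≤length-through {z} {M} z∉M =
    injection⇒length≤ (on-unique M) partner injective
    where
    partner : ∀ {x} → x ∈ on M → ∃[ N ] (N ∈ through z × I x N × I z N)
    partner x∈ with N , xN , zN , _ ← join _ z (λ { refl → z∉M (∈-on⁻ x∈) }) =
      N , ∈-through⁺ zN , xN , zN
    injective : ∀ {x x′ N} → x ∈ on M → x′ ∈ on M → I x N × I z N → I x′ N × I z N → x ≡ x′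
    injective {x} {x′} x∈ x′∈ (xN , zN) (x′N , _) with x ≟ x′
    ... | yes x≡x′ = x≡x′
    ... | no x≢x′  = ⊥-elim (z∉M (subst (I z) (join-unique x≢x′ xN x′N (∈-on⁻ x∈) (∈-on⁻ x′∈)) zN))

module IncidenceGraph (Π : ProjectivePlane) (I? : ∀ x L → Dec (ProjectivePlane.I Π x L)) where
  open ProjectivePlane Π
  open LinearSpace I I? lineThrough
  module Dual = LinearSpace (flip I) (flip I?) meet

  Γ : Graph
  Γ = incidenceGraph Π

  Element : Set
  Element = Fin p ⊎ Fin l

  _≟ₑ_ : (s t : Element) → Dec (s ≡ t)
  _≟ₑ_ = ≡-dec _≟_ _≟_

  ⟦_⟧ : Fin (p + l) → Element
  ⟦_⟧ = splitAt p

  vertex : Element → Fin (p + l)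
  vertex = join p l

  ⟦⟧-injective : ∀ {u v} → ⟦ u ⟧ ≡ ⟦ v ⟧ → u ≡ v
  ⟦⟧-injective {u} {v} e = trans (sym (join-splitAt p l u)) (trans (cong vertex e) (join-splitAt p l v))

  vertex-injective : ∀ {s t} → vertex s ≡ vertex t → s ≡ t
  vertex-injective {s} {t} e = trans (sym (splitAt-join p l s)) (trans (cong ⟦_⟧ e) (splitAt-join p l t))

  infix 4 _∼_
  data _∼_ : Element → Element → Set where
    point-line : ∀ {x L} → I x L → inj₁ x ∼ inj₂ L
    line-point : ∀ {x L} → I x L → inj₂ L ∼ inj₁ x

  _∼?_ : ∀ s t → Dec (s ∼ t)
  inj₁ x ∼? inj₂ L = map′ point-line (λ { (point-line xL) → xL }) (I? x L)
  inj₂ L ∼? inj₁ x = map′ line-point (λ { (line-point xL) → xL }) (I? x L)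
  inj₁ _ ∼? inj₁ _ = no λ ()
  inj₂ _ ∼? inj₂ _ = no λ ()

  isPoint : Element → Bool
  isPoint (inj₁ _) = true
  isPoint (inj₂ _) = false

  ∼⇒isPoint≢ : ∀ {s t} → s ∼ t → isPoint s ≢ isPoint t
  ∼⇒isPoint≢ (point-line _) ()
  ∼⇒isPoint≢ (line-point _) ()

  adjacent⇒∼ : ∀ {u v} → Graph.Adj Γ u v → ⟦ u ⟧ ∼ ⟦ v ⟧
  adjacent⇒∼ {u} {v} adj with splitAt p u | splitAt p v
  ... | inj₁ _ | inj₂ _ = point-line adj
  ... | inj₂ _ | inj₁ _ = line-point adj

  ∼⇒adjacent : ∀ {s t} → s ∼ t → Graph.Adj Γ (vertex s) (vertex t)
  ∼⇒adjacent (point-line {x} {L} xL) rewrite splitAt-↑ˡ p x l | splitAt-↑ʳ p l L = xL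
  ∼⇒adjacent (line-point {x} {L} xL) rewrite splitAt-↑ˡ p x l | splitAt-↑ʳ p l L = xL

  point-on : ∀ L → ∃[ y ] I y L
  point-on L with a , b , _ , _ , a≢b , _ ← nondegenerate
             with M , aM , bM , _ ← lineThrough a b a≢b
             with L ≟ M
  ... | yes refl = a , aM
  ... | no L≢M   = let y , yL , _ = meet L M L≢M in y , yL

  common-neighbour : ∀ {s t} → s ≢ t → isPoint s ≡ isPoint t → ∃[ m ] (s ∼ m × m ∼ t)
  common-neighbour {inj₁ x} {inj₁ y} x≢y _ =
    let L , xL , yL , _ = lineThrough x y (x≢y ∘ cong inj₁) in inj₂ L , point-line xL , line-point yL
  common-neighbour {inj₂ L} {inj₂ M} L≢M _ =
    let x , xL , xM , _ = meet L M (L≢M ∘ cong inj₂) in inj₁ x , line-point xL , point-line xM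

  path-of-length-three : ∀ {s t} → ¬ s ∼ t → isPoint s ≢ isPoint t →
    ∃[ m ] ∃[ m′ ] (s ∼ m × m ∼ m′ × m′ ∼ t)
  path-of-length-three {inj₁ x} {inj₂ L} x≁L _ =
    let y , yL = point-on L
        N , xN , yN , _ = lineThrough x y (λ { refl → x≁L (point-line yL) })
    in inj₂ N , inj₁ y , point-line xN , line-point yN , point-line yL
  path-of-length-three {inj₂ L} {inj₁ x} L≁x _ =
    let y , yL = point-on L
        N , xN , yN , _ = lineThrough x y (λ { refl → L≁x (line-point yL) })
    in inj₁ y , inj₂ N , line-point yL , point-line yN , line-point xN
  path-of-length-three {inj₁ _} {inj₁ _} _ different = ⊥-elim (different refl)
  path-of-length-three {inj₂ _} {inj₂ _} _ different = ⊥-elim (different refl)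

  data Distance (s t : Element) : ℕ → Set where
    same             : s ≡ t → Distance s t 0
    incident         : s ∼ t → Distance s t 1
    apart-same-kind  : s ≢ t → ¬ s ∼ t → isPoint s ≡ isPoint t → Distance s t 2
    apart-other-kind : ¬ s ∼ t → isPoint s ≢ isPoint t → Distance s t 3

  distance : ∀ s t → ∃ (Distance s t)
  distance s t with s ≟ₑ t | s ∼? t | isPoint s ≟ᵇ isPoint t
  ... | yes s≡t | _       | _         = 0 , same s≡t
  ... | no _    | yes s∼t | _         = 1 , incident s∼t
  ... | no s≢t  | no s≁t  | yes kinds = 2 , apart-same-kind s≢t s≁t kinds
  ... | no _    | no s≁t  | no kinds  = 3 , apart-other-kind s≁t kinds

  walk : ∀ {s t k} → Distance s t k → Walk Γ (vertex s) (vertex t) k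
  walk (same refl) = here
  walk (incident s∼t) = step (∼⇒adjacent s∼t) here
  walk (apart-same-kind s≢t _ kinds) =
    let _ , s∼m , m∼t = common-neighbour s≢t kinds
    in step (∼⇒adjacent s∼m) (step (∼⇒adjacent m∼t) here)
  walk (apart-other-kind s≁t kinds) =
    let _ , _ , s∼m , m∼m′ , m′∼t = path-of-length-three s≁t kinds
    in step (∼⇒adjacent s∼m) (step (∼⇒adjacent m∼m′) (step (∼⇒adjacent m′∼t) here))

  walk₀ : ∀ {u v} → Walk Γ u v 0 → ⟦ u ⟧ ≡ ⟦ v ⟧
  walk₀ here = refl

  walk₁ : ∀ {u v} → Walk Γ u v 1 → ⟦ u ⟧ ∼ ⟦ v ⟧
  walk₁ (step adj here) = adjacent⇒∼ adj

  walk₂ : ∀ {u v} → Walk Γ u v 2 → isPoint ⟦ u ⟧ ≡ isPoint ⟦ v ⟧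
  walk₂ (step adj (step adj′ here)) = ≢-≢⇒≡ (∼⇒isPoint≢ (adjacent⇒∼ adj)) (∼⇒isPoint≢ (adjacent⇒∼ adj′))

  no-shorter-walk : ∀ {u v k} → Distance ⟦ u ⟧ ⟦ v ⟧ k → ∀ {j} → j < k → ¬ Walk Γ u v j
  no-shorter-walk (incident u∼v)             {0} _ w = ∼⇒isPoint≢ u∼v (cong isPoint (walk₀ w))
  no-shorter-walk (apart-same-kind u≢v _ _)  {0} _ w = u≢v (walk₀ w)
  no-shorter-walk (apart-same-kind _ u≁v _)  {1} _ w = u≁v (walk₁ w)
  no-shorter-walk (apart-other-kind _ kinds) {0} _ w = kinds (cong isPoint (walk₀ w))
  no-shorter-walk (apart-other-kind u≁v _)   {1} _ w = u≁v (walk₁ w)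
  no-shorter-walk (apart-other-kind _ kinds) {2} _ w = kinds (walk₂ w)
  no-shorter-walk (incident _)               {suc _} (s≤s ())
  no-shorter-walk (apart-same-kind _ _ _)    {suc (suc _)} (s≤s (s≤s ()))
  no-shorter-walk (apart-other-kind _ _)     {suc (suc (suc _))} (s≤s (s≤s (s≤s ())))

  Distance⇒Dist : ∀ {u v k} → Distance ⟦ u ⟧ ⟦ v ⟧ k → Dist Γ u v k
  Distance⇒Dist {u} {v} D = shortest⇒Dist Γ
    (subst₂ (λ u v → Walk Γ u v _) (join-splitAt p l u) (join-splitAt p l v) (walk D))
    (no-shorter-walk D)

  Separates : Element → Element → Element → Set
  Separates w s t = ∀ {k} → Distance s w k → Distance t w k → ⊥

  separates⇒distinguishes : ∀ {w x y} → Separates ⟦ w ⟧ ⟦ x ⟧ ⟦ y ⟧ → Distinguishes Γ w x y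
  separates⇒distinguishes {w} {x} {y} separates k x-dist y-dist
    with _ , Dx ← distance ⟦ x ⟧ ⟦ w ⟧ | _ , Dy ← distance ⟦ y ⟧ ⟦ w ⟧ =
    separates (subst (Distance _ _) (Dist-unique Γ (Distance⇒Dist Dx) x-dist) Dx)
              (subst (Distance _ _) (Dist-unique Γ (Distance⇒Dist Dy) y-dist) Dy)

  distinguishes⇒separates : ∀ {w x y} → Distinguishes Γ w x y → Separates ⟦ w ⟧ ⟦ x ⟧ ⟦ y ⟧
  distinguishes⇒separates distinguishes Dx Dy = distinguishes _ (Distance⇒Dist Dx) (Distance⇒Dist Dy)

  Close : Element → Element → Set
  Close s t = s ≡ t ⊎ s ∼ t

  close? : ∀ s t → Dec (Close s t)
  close? s t = (s ≟ₑ t) ⊎-dec (s ∼? t)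

  separates-from-self : ∀ {s t} → t ≢ s → Separates s s t
  separates-from-self t≢s (same _)                  (same t≡s) = t≢s t≡s
  separates-from-self _   (incident s∼s)            _          = ∼⇒isPoint≢ s∼s refl
  separates-from-self _   (apart-same-kind s≢s _ _) _          = s≢s refl
  separates-from-self _   (apart-other-kind _ kinds) _         = kinds refl

  separates-incident : ∀ {w s t} → s ∼ w → ¬ t ∼ w → Separates w s t
  separates-incident s∼w _   (same refl)               _              = ∼⇒isPoint≢ s∼w refl
  separates-incident _   t≁w (incident _)              (incident t∼w) = t≁w t∼w
  separates-incident s∼w _   (apart-same-kind _ s≁w _) _              = s≁w s∼w
  separates-incident s∼w _   (apart-other-kind s≁w _)  _              = s≁w s∼w

  separates-kinds : ∀ {w s t} → isPoint s ≢ isPoint t → Separates w s t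
  separates-kinds kinds (same refl)     (same refl)     = kinds refl
  separates-kinds kinds (incident s∼w)  (incident t∼w)  =
    kinds (≢-≢⇒≡ (∼⇒isPoint≢ s∼w) (∼⇒isPoint≢ t∼w ∘ sym))
  separates-kinds kinds (apart-same-kind _ _ sw) (apart-same-kind _ _ tw) = kinds (trans sw (sym tw))
  separates-kinds kinds (apart-other-kind _ sw)  (apart-other-kind _ tw)  = kinds (≢-≢⇒≡ sw (tw ∘ sym))

  equally-close⇒¬separates : ∀ {w s t} → isPoint s ≡ isPoint t → s ≢ t →
    (Close s w → Close t w) → (Close t w → Close s w) → ¬ Separates w s t
  equally-close⇒¬separates {w} {s} {t} kinds s≢t to from separates with close? s w
  ... | yes s-close = both-close s-close (to s-close)
    where
    both-close : Close s w → Close t w → ⊥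
    both-close (inj₁ refl) (inj₁ refl) = s≢t refl
    both-close (inj₁ refl) (inj₂ t∼s)  = ∼⇒isPoint≢ t∼s (sym kinds)
    both-close (inj₂ s∼t)  (inj₁ refl) = ∼⇒isPoint≢ s∼t kinds
    both-close (inj₂ s∼w)  (inj₂ t∼w)  = separates (incident s∼w) (incident t∼w)
  ... | no s-far with isPoint s ≟ᵇ isPoint w
  ...   | yes sw = separates (apart-same-kind (s-far ∘ inj₁) (s-far ∘ inj₂) sw)
                             (apart-same-kind (t-far ∘ inj₁) (t-far ∘ inj₂) (trans (sym kinds) sw))
    where
    t-far : ¬ Close t w
    t-far = s-far ∘ from
  ...   | no sw  = separates (apart-other-kind (s-far ∘ inj₂) sw)
                             (apart-other-kind (s-far ∘ from ∘ inj₂) (sw ∘ trans kinds))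

  common-neighbours-unique : ∀ {s t w w′} → w ≢ w′ → s ∼ w → s ∼ w′ → t ∼ w → t ∼ w′ → s ≡ t
  common-neighbours-unique L≢L′ (point-line xL) (point-line xL′) (point-line yL) (point-line yL′) =
    cong inj₁ (Dual.join-unique (L≢L′ ∘ cong inj₂) xL xL′ yL yL′)
  common-neighbours-unique x≢y (line-point xM) (line-point yM) (line-point xM′) (line-point yM′) =
    cong inj₂ (join-unique (x≢y ∘ cong inj₁) xM yM xM′ yM′)

  same-kind-close : ∀ {s t} → isPoint s ≡ isPoint t → Close t s → s ≡ t
  same-kind-close _     (inj₁ t≡s) = sym t≡s
  same-kind-close kinds (inj₂ t∼s) = ⊥-elim (∼⇒isPoint≢ t∼s (sym kinds))

  close-unique : ∀ {s t w w′} → isPoint s ≡ isPoint t → w ≢ w′ →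
    Close s w → Close s w′ → Close t w → Close t w′ → s ≡ t
  close-unique kinds _ (inj₁ refl) _ t-close _ = same-kind-close kinds t-close
  close-unique kinds _ (inj₂ _) (inj₁ refl) _ t-close = same-kind-close kinds t-close
  close-unique kinds _ (inj₂ s∼w) _ (inj₁ refl) _ = sym (same-kind-close (sym kinds) (inj₂ s∼w))
  close-unique kinds _ (inj₂ _) (inj₂ s∼w′) (inj₂ _) (inj₁ refl) =
    sym (same-kind-close (sym kinds) (inj₂ s∼w′))
  close-unique _ w≢w′ (inj₂ s∼w) (inj₂ s∼w′) (inj₂ t∼w) (inj₂ t∼w′) =
    common-neighbours-unique w≢w′ s∼w s∼w′ t∼w t∼w′

  module _ {R : Subset (p + l)} (resolving : Resolving Γ R) where

    resolvers : List (Fin (p + l))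
    resolvers = elements R

    resolver : Fin (length resolvers) → Element
    resolver i = ⟦ lookup resolvers i ⟧

    separated-by-resolver : ∀ {s t} → s ≢ t → ∃[ i ] Separates (resolver i) s t
    separated-by-resolver {s} {t} s≢t
      with w , w∈R , distinguishes ← resolving (vertex s) (vertex t) (s≢t ∘ vertex-injective) =
      index w∈ ,
      subst₂ (Separates _) (splitAt-join p l s) (splitAt-join p l t)
        (subst (λ w → Separates ⟦ w ⟧ _ _) (lookup-index w∈) (distinguishes⇒separates distinguishes))
      where
      w∈ : w ∈ resolvers
      w∈ = ∈-elements⁺ w∈R

    kind-size≤ : ∀ {m} (embed : Fin m → Element) → (∀ {x y} → embed x ≡ embed y → x ≡ y) →
      (∀ x y → isPoint (embed x) ≡ isPoint (embed y)) →
      m ≤ suc (length resolvers) * suc (length resolvers)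
    kind-size≤ {m} embed embed-injective kinds = injective⇒≤ encode-injective
      where
      open CloseCode _≟ₑ_ (Close ∘ embed) (close? ∘ embed) resolver

      code-injective : ∀ {x y} → code x ≡ code y → x ≡ y
      code-injective {x} {y} eq with same-code eq
      ... | inj₂ (_ , _ , b≢b′ , xb , xb′ , yb , yb′) =
        embed-injective (close-unique (kinds x y) b≢b′ xb xb′ yb yb′)
      ... | inj₁ (x⊆y , y⊆x) with x ≟ y
      ...   | yes x≡y = x≡y
      ...   | no x≢y
        with i , separates ← separated-by-resolver (x≢y ∘ embed-injective) =
        ⊥-elim (equally-close⇒¬separates (kinds x y) (x≢y ∘ embed-injective) (x⊆y i) (y⊆x i) separates)

      encode : Fin m → Fin (suc (length resolvers) * suc (length resolvers))
      encode x = combine (toFin (proj₁ (code x))) (toFin (proj₂ (code x)))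

      encode-injective : ∀ {x y} → encode x ≡ encode y → x ≡ y
      encode-injective {x} {y} eq =
        let eq₁ , eq₂ = combine-injective _ _ _ _ eq
        in code-injective (cong₂ _,_ (toFin-injective eq₁) (toFin-injective eq₂))

    lower-bound : p + l ≤ 8 * (∣ R ∣ * ∣ R ∣)
    lower-bound with a , b , _ , _ , a≢b , _ ← nondegenerate =
      subst (λ r → p + l ≤ 8 * (r * r)) (length-elements R)
        (square-bound (≤-<-trans z≤n (toℕ<n (proj₁ (separated-by-resolver (a≢b ∘ inj₁-injective)))))
          (kind-size≤ inj₁ inj₁-injective λ _ _ → refl)
          (kind-size≤ inj₂ inj₂-injective λ _ _ → refl))

  module Quadrangle {a b c d : Fin p}
    (a≢b : a ≢ b) (a≢c : a ≢ c) (a≢d : a ≢ d) (b≢c : b ≢ c) (b≢d : b ≢ d)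
    (¬abc : ¬ (∃[ L ] (I a L × I b L × I c L))) (¬abd : ¬ (∃[ L ] (I a L × I b L × I d L)))
    (¬acd : ¬ (∃[ L ] (I a L × I c L × I d L))) (¬bcd : ¬ (∃[ L ] (I b L × I c L × I d L))) where

    ab ac ad bc bd : Fin l
    ab = line-of a≢b
    ac = line-of a≢c
    ad = line-of a≢d
    bc = line-of b≢c
    bd = line-of b≢d

    c∉ab : ¬ I c ab
    c∉ab c∈ = ¬abc (ab , on-line-ofˡ a≢b , on-line-ofʳ a≢b , c∈)
    d∉ab : ¬ I d ab
    d∉ab d∈ = ¬abd (ab , on-line-ofˡ a≢b , on-line-ofʳ a≢b , d∈)
    b∉ac : ¬ I b ac
    b∉ac b∈ = ¬abc (ac , on-line-ofˡ a≢c , b∈ , on-line-ofʳ a≢c)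
    d∉ac : ¬ I d ac
    d∉ac d∈ = ¬acd (ac , on-line-ofˡ a≢c , on-line-ofʳ a≢c , d∈)
    b∉ad : ¬ I b ad
    b∉ad b∈ = ¬abd (ad , on-line-ofˡ a≢d , b∈ , on-line-ofʳ a≢d)
    a∉bc : ¬ I a bc
    a∉bc a∈ = ¬abc (bc , a∈ , on-line-ofˡ b≢c , on-line-ofʳ b≢c)
    d∉bc : ¬ I d bc
    d∉bc d∈ = ¬bcd (bc , on-line-ofˡ b≢c , on-line-ofʳ b≢c , d∈)

    ab≢ac : ab ≢ ac
    ab≢ac ab≡ac = c∉ab (subst (I c) (sym ab≡ac) (on-line-ofʳ a≢c))
    ab≢ad : ab ≢ ad
    ab≢ad ab≡ad = d∉ab (subst (I d) (sym ab≡ad) (on-line-ofʳ a≢d))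
    bd≢ad : bd ≢ ad
    bd≢ad bd≡ad = b∉ad (subst (I b) bd≡ad (on-line-ofˡ b≢d))

    InR₀ : Element → Set
    InR₀ (inj₁ x) = I x ab ⊎ I x ac
    InR₀ (inj₂ L) = I a L ⊎ I b L

    InR₀? : ∀ s → Dec (InR₀ s)
    InR₀? (inj₁ x) = I? x ab ⊎-dec I? x ac
    InR₀? (inj₂ L) = I? a L ⊎-dec I? b L

    separated-outside-R₀ : ∀ {s t} → s ≢ t → isPoint s ≡ isPoint t → ¬ InR₀ s →
      ∃[ w ] (InR₀ w × Separates w s t)
    separated-outside-R₀ {inj₁ x} {inj₁ y} x≢y _ x∉ =
      let N , aN⊎bN , xN , y∉N =
            separating-line a≢b (on-line-ofˡ a≢b) (on-line-ofʳ a≢b) (x∉ ∘ inj₁) (x≢y ∘ cong inj₁)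
      in inj₂ N , aN⊎bN , separates-incident (point-line xN) λ { (point-line yN) → y∉N yN }
    -- Dually, the lines ab and ac, which meet in a, play the roles of the points a and b.
    separated-outside-R₀ {inj₂ L} {inj₂ L′} L≢L′ _ L∌ =
      let u , u∈ , uL , u∉L′ =
            Dual.separating-line ab≢ac (on-line-ofˡ a≢b) (on-line-ofˡ a≢c) (L∌ ∘ inj₁) (L≢L′ ∘ cong inj₂)
      in inj₁ u , u∈ , separates-incident (line-point uL) λ { (line-point uL′) → u∉L′ uL′ }

    separated-by-R₀ : ∀ {s t} → s ≢ t → ∃[ w ] (InR₀ w × Separates w s t)
    separated-by-R₀ {s} {t} s≢t with isPoint s ≟ᵇ isPoint t | InR₀? s | InR₀? t
    ... | no kinds  | _      | _      = inj₁ a , inj₁ (on-line-ofˡ a≢b) , separates-kinds kinds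
    ... | yes _     | yes s∈ | _      = s , s∈ , separates-from-self (s≢t ∘ sym)
    ... | yes _     | no _   | yes t∈ = t , t∈ , λ Ds Dt → separates-from-self s≢t Dt Ds
    ... | yes kinds | no s∉  | no _   = separated-outside-R₀ s≢t kinds s∉

    R₀ : Subset (p + l)
    R₀ = subset (InR₀? ∘ ⟦_⟧)

    R₀-resolving : Resolving Γ R₀
    R₀-resolving u v u≢v with w , w∈ , separates ← separated-by-R₀ (u≢v ∘ ⟦⟧-injective) =
      vertex w , ∈-subset⁺ {P? = InR₀? ∘ ⟦_⟧} (subst InR₀ (sym (splitAt-join p l w)) w∈) ,
      separates⇒distinguishes (subst (λ w → Separates w _ _) (sym (splitAt-join p l w)) separates)

    R₀-elements : List Element
    R₀-elements = map inj₁ (on ab ++ on ac) ++ map inj₂ (through a ++ through b)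

    InR₀⇒∈ : ∀ {s} → InR₀ s → s ∈ R₀-elements
    InR₀⇒∈ {inj₁ _} (inj₁ x∈ab) = ∈-++⁺ˡ (∈-map⁺ inj₁ (∈-++⁺ˡ (∈-on⁺ x∈ab)))
    InR₀⇒∈ {inj₁ _} (inj₂ x∈ac) = ∈-++⁺ˡ (∈-map⁺ inj₁ (∈-++⁺ʳ (on ab) (∈-on⁺ x∈ac)))
    InR₀⇒∈ {inj₂ _} (inj₁ a∈L)  = ∈-++⁺ʳ _ (∈-map⁺ inj₂ (∈-++⁺ˡ (∈-through⁺ a∈L)))
    InR₀⇒∈ {inj₂ _} (inj₂ b∈L)  = ∈-++⁺ʳ _ (∈-map⁺ inj₂ (∈-++⁺ʳ (through a) (∈-through⁺ b∈L)))

    ∣R₀∣≤ : ∣ R₀ ∣ ≤ length R₀-elements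
    ∣R₀∣≤ = injection⇒∣p∣≤length {R = λ v s → ⟦ v ⟧ ≡ s}
      (λ {v} v∈ → ⟦ v ⟧ , InR₀⇒∈ (∈-subset⁻ {P? = InR₀? ∘ ⟦_⟧} v∈) , refl)
      (λ e e′ → ⟦⟧-injective (trans e (sym e′)))

    K : ℕ
    K = length (through d)

    K≤through-a : K ≤ length (through a)
    K≤through-a = ≤-trans (Dual.length-on≤length-through d∉bc) (length-on≤length-through a∉bc)

    R₀-elements≤4K : length R₀-elements ≤ 4 * K
    R₀-elements≤4K = begin
      length R₀-elements
        ≡⟨ length-++ (map inj₁ (on ab ++ on ac)) ⟩
      length (map inj₁ (on ab ++ on ac)) + length (map inj₂ (through a ++ through b))
        ≡⟨ cong₂ _+_ (trans (length-map inj₁ (on ab ++ on ac)) (length-++ (on ab)))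
                     (trans (length-map inj₂ (through a ++ through b)) (length-++ (through a))) ⟩
      (length (on ab) + length (on ac)) + (length (through a) + length (through b))
        ≤⟨ +-mono-≤ (+-mono-≤ (length-on≤length-through d∉ab) (length-on≤length-through d∉ac))
                    (+-mono-≤ (≤-trans (Dual.length-on≤length-through a∉bc) (length-on≤length-through d∉bc))
                              (≤-trans (Dual.length-on≤length-through b∉ac) (length-on≤length-through d∉ac))) ⟩
      (K + K) + (K + K)
        ≡⟨ identity K ⟩
      4 * K ∎
      where
      open ≤-Reasoning
      identity : ∀ k → (k + k) + (k + k) ≡ 4 * k
      identity = solve-∀

    avoiding-ad : Fin p → List (Fin l)
    avoiding-ad x = filter (λ L → ¬? (L ≟ ad)) (through x)

    ∈-avoiding-ad⁺ : ∀ {x L} → I x L → L ≢ ad → L ∈ avoiding-ad x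
    ∈-avoiding-ad⁺ xL L≢ad = ∈-filter⁺ (λ L → ¬? (L ≟ ad)) (∈-through⁺ xL) L≢ad

    ∈-avoiding-ad⁻ : ∀ {x L} → L ∈ avoiding-ad x → I x L × L ≢ ad
    ∈-avoiding-ad⁻ {x} L∈ =
      let L∈through , L≢ad = ∈-filter⁻ (λ L → ¬? (L ≟ ad)) {xs = through x} L∈
      in ∈-through⁻ L∈through , L≢ad

    length-avoiding-ad : ∀ x → length (through x) ≤ suc (length (avoiding-ad x))
    length-avoiding-ad x = length≤suc-length-without _≟_ ad (through-unique x)

    through-d-and-a⇒ad : ∀ {L} → I d L → I a L → L ≡ ad
    through-d-and-a⇒ad dL aL = join-unique a≢d aL dL (on-line-ofˡ a≢d) (on-line-ofʳ a≢d)

    -- The point L ∧ L′ determines both L (its join with d) and L′ (its join with a).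
    pairs≤ : length (avoiding-ad d) * length (avoiding-ad a) ≤ p
    pairs≤ = subst₂ _≤_ (length-cartesianProduct (avoiding-ad d) (avoiding-ad a)) (length-tabulate id)
      (injection⇒length≤ (Unique.cartesianProduct⁺ (avoiding-unique d) (avoiding-unique a))
                         meeting-point injective)
      where
      avoiding-unique : ∀ x → Unique (avoiding-ad x)
      avoiding-unique x = Unique.filter⁺ (λ L → ¬? (L ≟ ad)) (through-unique x)
      Pairs : List (Fin l × Fin l)
      Pairs = cartesianProduct (avoiding-ad d) (avoiding-ad a)
      meeting-point : ∀ {LL′} → LL′ ∈ Pairs → ∃[ x ] (x ∈ allFin p × I x (proj₁ LL′) × I x (proj₂ LL′))
      meeting-point {L , L′} LL′∈ =
        let L∈ , L′∈ = ∈-cartesianProduct⁻ (avoiding-ad d) (avoiding-ad a) LL′∈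
            dL , L≢ad = ∈-avoiding-ad⁻ L∈
            aL′ , _ = ∈-avoiding-ad⁻ L′∈
            x , xL , xL′ , _ = meet L L′ (λ { refl → L≢ad (through-d-and-a⇒ad dL aL′) })
        in x , ∈-allFin x , xL , xL′
      injective : ∀ {LL′₁ LL′₂ x} → LL′₁ ∈ Pairs → LL′₂ ∈ Pairs →
        I x (proj₁ LL′₁) × I x (proj₂ LL′₁) → I x (proj₁ LL′₂) × I x (proj₂ LL′₂) → LL′₁ ≡ LL′₂
      injective {L₁ , L₁′} {L₂ , L₂′} {x} ∈₁ ∈₂ (xL₁ , xL₁′) (xL₂ , xL₂′) =
        let L₁∈ , L₁′∈ = ∈-cartesianProduct⁻ (avoiding-ad d) (avoiding-ad a) ∈₁
            L₂∈ , L₂′∈ = ∈-cartesianProduct⁻ (avoiding-ad d) (avoiding-ad a) ∈₂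
            dL₁ , L₁≢ad = ∈-avoiding-ad⁻ L₁∈
            aL₁′ , L₁′≢ad = ∈-avoiding-ad⁻ L₁′∈
            dL₂ , _ = ∈-avoiding-ad⁻ L₂∈
            aL₂′ , _ = ∈-avoiding-ad⁻ L₂′∈
            x≢d : x ≢ d
            x≢d = λ { refl → L₁′≢ad (through-d-and-a⇒ad xL₁′ aL₁′) }
            x≢a : x ≢ a
            x≢a = λ { refl → L₁≢ad (through-d-and-a⇒ad dL₁ xL₁) }
        in cong₂ _,_ (join-unique x≢d xL₁ dL₁ xL₂ dL₂) (join-unique x≢a xL₁′ aL₁′ xL₂′ aL₂′)

    upper-bound : ∀ {μ} → (∀ R → Resolving Γ R → μ ≤ ∣ R ∣) → μ * μ ≤ 64 * (p + l)
    upper-bound minimal =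
      product-bound (≤-trans (minimal R₀ R₀-resolving) (≤-trans ∣R₀∣≤ R₀-elements≤4K))
        (length-avoiding-ad d) (≤-trans K≤through-a (length-avoiding-ad a))
        (∈-length (∈-avoiding-ad⁺ (on-line-ofʳ b≢d) bd≢ad))
        (∈-length (∈-avoiding-ad⁺ (on-line-ofˡ a≢b) ab≢ad))
        (≤-trans pairs≤ (m≤m+n p l))

  upper-bound : ∀ {μ} → (∀ R → Resolving Γ R → μ ≤ ∣ R ∣) → μ * μ ≤ 64 * (p + l)
  upper-bound
    with _ , _ , _ , _ , a≢b , a≢c , a≢d , b≢c , b≢d , _ , ¬abc , ¬abd , ¬acd , ¬bcd ← nondegenerate =
    Quadrangle.upper-bound a≢b a≢c a≢d b≢c b≢d ¬abc ¬abd ¬acd ¬bcd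

metric-dimension-bounds : ∀ Π → (∀ x L → Dec (ProjectivePlane.I Π x L)) → ∀ {μ} →
  IsMetricDim (incidenceGraph Π) μ →
  Graph.n (incidenceGraph Π) ≤ 8 * (μ * μ) × μ * μ ≤ 64 * Graph.n (incidenceGraph Π)
metric-dimension-bounds Π I? ((_ , resolving , refl) , minimal) =
  lower-bound resolving , upper-bound minimal
  where open IncidenceGraph Π I?

incidence-¬¬-decidable : ∀ Π → ¬ ¬ (∀ x L → Dec (ProjectivePlane.I Π x L))
incidence-¬¬-decidable Π = ¬¬-∀-Fin p λ x → ¬¬-∀-Fin l λ L → ¬¬-excluded-middle
  where open ProjectivePlane Π

corollary4p4 :
    ∃[ a ] ∃[ b ] (0 < a × 0 < b ×
      (∀ (Π : ProjectivePlane) (μ : ℕ) →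
        IsMetricDim (incidenceGraph Π) μ →
        Graph.n (incidenceGraph Π) ≤ a * (μ * μ)
        × μ * μ ≤ b * Graph.n (incidenceGraph Π)))
corollary4p4 = 8 , 64 , s≤s z≤n , s≤s z≤n , λ Π μ dimension →
  decidable-stable ((_ ≤? _) ×-dec (_ ≤? _)) λ ¬bounds →
    incidence-¬¬-decidable Π λ I? → ¬bounds (metric-dimension-bounds Π I? dimension)
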